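{- Let $(A,V)$ be a permutation group on a finite set with $A\in DGR\setminus GR$. Then $A\times I_2\in GR$.
   Context: A permutation group $(A,V)$ is a group $A$ of permutations of a set $V$; $I_n$ denotes the trivial group (identity only) acting on an $n$-element set; groups are considered up to permutation isomorphism. The direct product of $(A,V)$ and $(B,W)$ acts on $V\times W$ by $(a,b)(x,y)=(a(x),b(y))$. An edge-colored graph on a set $U$ is a function $E$ from the 2-element subsets of $U$ to a finite set of colors, with automorphisms the permutations $\sigma$ of $U$ satisfying $E(\{\sigma(u),\sigma(u')\})=E(\{u,u'\})$ for all distinct $u,u'$; an edge-colored digraph is defined the same way with ordered pairs $(u,u')$, $u\neq u'$, in place of 2-element subsets. $GR$ (resp. $DGR$) is the class of permutation groups that equal the full automorphism group of some edge-colored graph (resp. digraph) on their underlying set. -}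

module Defs where

open import Level using (0ℓ)
open import Data.Nat using (ℕ)
open import Data.Fin using (Fin)
open import Data.Product using (Σ; ∃; _×_; _,_)
open import Function using (_↔_; Inverse; _⇔_)
open import Function.Construct.Identity using (↔-id)
open import Function.Construct.Composition using (_↔-∘_)
open import Function.Construct.Symmetry using (↔-sym)
open import Relation.Binary.PropositionalEquality using (_≡_; _≢_)

Perm : Set → Set
Perm V = V ↔ V

app : {V : Set} → Perm V → V → V
app σ = Inverse.to σ

_≈ₚ_ : {V : Set} → Perm V → Perm V → Set
σ ≈ₚ τ = ∀ x → app σ x ≡ app τ x

Finite : Set → Set
Finite V = Σ ℕ λ n → V ↔ Fin n

record PermGroup (V : Set) : Set₁ where
  field
    mem    : Perm V → Set
    resp   : ∀ {σ τ} → σ ≈ₚ τ → mem σ → mem τ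
    id∈    : mem (↔-id V)
    ∘∈     : ∀ {σ τ} → mem σ → mem τ → mem (σ ↔-∘ τ)
    inv∈   : ∀ {σ} → mem σ → mem (↔-sym σ)

open PermGroup public

_∈G_ : {V : Set} → PermGroup V → Perm V → Set
A ∈G σ = mem A σ

-- An edge-colored digraph on V with colors in a finite set Fin k:
-- a colour for each ordered pair (u , u') (values on the diagonal are ignored).
DiColoring : Set → ℕ → Set
DiColoring V k = V → V → Fin k

-- An edge-colored graph: a colour for each 2-element subset {u , u'},
-- represented as a function on ordered pairs that is symmetric off the diagonal.
Coloring : Set → ℕ → Set
Coloring V k = Σ (DiColoring V k) λ E → ∀ u u' → u ≢ u' → E u u' ≡ E u' u

IsAut : {V : Set} {k : ℕ} → DiColoring V k → Perm V → Set
IsAut E σ = ∀ u u' → u ≢ u' → E (app σ u) (app σ u') ≡ E u u'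

IsAutGroupOf : {V : Set} {k : ℕ} → PermGroup V → DiColoring V k → Set
IsAutGroupOf A E = ∀ σ → (A ∈G σ) ⇔ IsAut E σ

InGR : {V : Set} → PermGroup V → Set
InGR {V} A = Σ ℕ λ k → Σ (Coloring V k) λ { (E , _) → IsAutGroupOf A E }

InDGR : {V : Set} → PermGroup V → Set
InDGR {V} A = Σ ℕ λ k → Σ (DiColoring V k) λ E → IsAutGroupOf A E

record _×I₂-mem_ {V : Set} (A : PermGroup V) (τ : Perm (V × Fin 2)) : Set where
  constructor mk×I₂
  field
    base   : Perm V
    base∈  : A ∈G base
    acts   : ∀ x i → app τ (x , i) ≡ (app base x , i)

open import Relation.Binary.PropositionalEquality using (refl; sym; trans; cong)

_×I₂ : {V : Set} → PermGroup V → PermGroup (V × Fin 2)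
_×I₂ {V} A = record
  { mem  = A ×I₂-mem_
  ; resp = λ {σ} {τ} eq m → mk×I₂ (base m) (base∈ m) (λ x i → trans (sym (eq (x , i))) (acts m x i))
  ; id∈  = mk×I₂ (↔-id V) (id∈ A) (λ x i → refl)
  ; ∘∈   = λ {σ} {τ} mσ mτ → mk×I₂ (base mσ ↔-∘ base mτ) (∘∈ A (base∈ mσ) (base∈ mτ))
             (λ x i → trans (cong (app σ) (acts mτ x i)) (acts mσ (app (base mτ) x) i))
  ; inv∈ = λ {σ} mσ → mk×I₂ (↔-sym (base mσ)) (inv∈ A (base∈ mσ))
             (λ x i → trans
                (cong (Inverse.from σ)
                  (sym (trans (acts mσ (Inverse.from (base mσ) x) i)
                              (cong (_, i) (Inverse.strictlyInverseˡ (base mσ) x)))))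
                (Inverse.strictlyInverseʳ σ (Inverse.from (base mσ) x , i)))
  }
  where open _×I₂-mem_

-- Double the digraph: take two copies of V, colour all edges inside copy i
-- with a private colour cᵢ, the rungs {(u,0),(u,1)} with a third colour, and
-- the cross edge {(u,0),(u',1)} with the colour of the arc (u,u').  Inside a
-- copy every vertex has a cᵢ-edge unless |V| = 1, so automorphisms keep the
-- copies, the rungs force them to act alike on both, and the cross edges
-- recover the arcs of the digraph: the automorphism group is exactly A × I₂.
-- The hypothesis A ∉ GR only serves to exclude |V| = 1, where swapping the
-- copies would be an extra automorphism.
module Submission where

open import Defs
open import Data.Empty using (⊥-elim)
open import Data.Fin using (Fin; zero; suc; _↑ʳ_)
open import Data.Fin.Properties using (any?; inj⇒≟; ↑ʳ-injective)
open import Data.Nat using (ℕ; _+_)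
open import Data.Product using (_×_; _,_; proj₁; proj₂; ∃-syntax)
open import Function using (_∘_; Inverse; Injection; mk⇔; Equivalence)
open import Function.Bundles using (mk↔ₛ′)
open import Function.Properties.Inverse using (↔⇒↣)
open import Relation.Binary.Definitions using (DecidableEquality)
open import Relation.Binary.PropositionalEquality
  using (_≡_; _≢_; refl; sym; trans; cong; cong₂; subst; module ≡-Reasoning)
open import Relation.Nullary using (¬_; yes; no; ¬?)
open import Relation.Nullary.Decidable using (decidable-stable)

subsingleton⇒InGR : {V : Set} (A : PermGroup V) → (∀ (v w : V) → v ≡ w) → InGR A
subsingleton⇒InGR A all≡ =
  1 , ((λ _ _ → zero) , λ _ _ _ → refl) ,
  λ σ → mk⇔ (λ _ _ _ _ → refl) (λ _ → resp A (λ x → all≡ x (app σ x)) (id∈ A))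

finite⇒≟ : {V : Set} → Finite V → DecidableEquality V
finite⇒≟ (_ , φ) = inj⇒≟ (↔⇒↣ φ)

¬InGR⇒another : {V : Set} → Finite V → (A : PermGroup V) → ¬ InGR A → (u : V) → ∃[ u' ] u' ≢ u
¬InGR⇒another fin@(_ , φ) A A∉GR u with any? (λ j → ¬? (finite⇒≟ fin (Inverse.from φ j) u))
... | yes (j , ≢u) = Inverse.from φ j , ≢u
... | no ∄ = ⊥-elim (A∉GR (subsingleton⇒InGR A λ v w → trans (≡u v) (sym (≡u w))))
  where
  ≡u : ∀ v → v ≡ u
  ≡u v = decidable-stable (finite⇒≟ fin v u) λ v≢u →
    ∄ (Inverse.to φ v , subst (_≢ u) (sym (Inverse.strictlyInverseʳ φ v)) v≢u)

module LayerPreserving {V L : Set} (τ : Perm (V × L))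
                       (keeps : ∀ x i → proj₂ (app τ (x , i)) ≡ i) where

  from-keeps : ∀ y i → proj₂ (Inverse.from τ (y , i)) ≡ i
  from-keeps y i = trans (sym (keeps _ _)) (cong proj₂ (Inverse.strictlyInverseˡ τ (y , i)))

  from-η : ∀ y i → Inverse.from τ (y , i) ≡ (proj₁ (Inverse.from τ (y , i)) , i)
  from-η y i = cong (proj₁ (Inverse.from τ (y , i)) ,_) (from-keeps y i)

  to-η : ∀ x i → app τ (x , i) ≡ (proj₁ (app τ (x , i)) , i)
  to-η x i = cong (proj₁ (app τ (x , i)) ,_) (keeps x i)

  fibre : L → Perm V
  fibre i = mk↔ₛ′ (λ x → proj₁ (app τ (x , i))) (λ y → proj₁ (Inverse.from τ (y , i)))
    (λ y → cong proj₁ (trans (cong (app τ) (sym (from-η y i))) (Inverse.strictlyInverseˡ τ (y , i))))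
    (λ x → cong proj₁ (trans (cong (Inverse.from τ) (sym (to-η x i))) (Inverse.strictlyInverseʳ τ (x , i))))

  app-fibre : ∀ x i → app τ (x , i) ≡ (app (fibre i) x , i)
  app-fibre = to-η

module Doubling {V : Set} (_≟_ : DecidableEquality V) {k : ℕ} (E : DiColoring V k) where

  inner : Fin 2 → Fin (3 + k)
  inner zero       = zero
  inner (suc zero) = suc zero

  rung : Fin (3 + k)
  rung = suc (suc zero)

  arc : V → V → Fin (3 + k)
  arc u u' with u ≟ u'
  ... | yes _ = rung
  ... | no _  = 3 ↑ʳ E u u'

  double : DiColoring (V × Fin 2) (3 + k)
  double (u , zero)     (u' , zero)     = inner zero
  double (u , suc zero) (u' , suc zero) = inner (suc zero)
  double (u , zero)     (u' , suc zero) = arc u u'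
  double (u , suc zero) (u' , zero)     = arc u' u

  double-sym : ∀ p q → p ≢ q → double p q ≡ double q p
  double-sym (u , zero)     (u' , zero)     _ = refl
  double-sym (u , zero)     (u' , suc zero) _ = refl
  double-sym (u , suc zero) (u' , zero)     _ = refl
  double-sym (u , suc zero) (u' , suc zero) _ = refl

  double-within : ∀ u u' i → double (u , i) (u' , i) ≡ inner i
  double-within u u' zero       = refl
  double-within u u' (suc zero) = refl

  arc-refl : ∀ u → arc u u ≡ rung
  arc-refl u with u ≟ u
  ... | yes _  = refl
  ... | no u≢u = ⊥-elim (u≢u refl)

  arc-≢ : ∀ {u u'} → u ≢ u' → arc u u' ≡ 3 ↑ʳ E u u'
  arc-≢ {u} {u'} u≢u' with u ≟ u'
  ... | yes u≡u' = ⊥-elim (u≢u' u≡u')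
  ... | no _     = refl

  arc≡rung⇒≡ : ∀ u u' → arc u u' ≡ rung → u ≡ u'
  arc≡rung⇒≡ u u' with u ≟ u'
  ... | yes u≡u' = λ _ → u≡u'
  ... | no _     = λ ()

  arc≡↑ʳ⇒E≡ : ∀ u u' c → arc u u' ≡ 3 ↑ʳ c → E u u' ≡ c
  arc≡↑ʳ⇒E≡ u u' c with u ≟ u'
  ... | yes _ = λ ()
  ... | no _  = ↑ʳ-injective 3 _ _

  arc≢inner : ∀ u u' i → arc u u' ≢ inner i
  arc≢inner u u' i with u ≟ u' | i
  ... | yes _ | zero     = λ ()
  ... | yes _ | suc zero = λ ()
  ... | no _  | zero     = λ ()
  ... | no _  | suc zero = λ ()

  double≡inner⇒layer : ∀ p q i → double p q ≡ inner i → proj₂ p ≡ i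
  double≡inner⇒layer (u , zero)     (u' , zero)     zero       _  = refl
  double≡inner⇒layer (u , zero)     (u' , zero)     (suc zero) ()
  double≡inner⇒layer (u , suc zero) (u' , suc zero) zero       ()
  double≡inner⇒layer (u , suc zero) (u' , suc zero) (suc zero) _  = refl
  double≡inner⇒layer (u , zero)     (u' , suc zero) i          eq = ⊥-elim (arc≢inner u u' i eq)
  double≡inner⇒layer (u , suc zero) (u' , zero)     i          eq = ⊥-elim (arc≢inner u' u i eq)

  arc-IsAut : ∀ β → IsAut E β → ∀ u u' → arc (app β u) (app β u') ≡ arc u u'
  arc-IsAut β β-aut u u' with u ≟ u'
  ... | yes refl = arc-refl _
  ... | no u≢u'  = begin
    arc (app β u) (app β u')    ≡⟨ arc-≢ (u≢u' ∘ Injection.injective (↔⇒↣ β)) ⟩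
    3 ↑ʳ E (app β u) (app β u') ≡⟨ cong (3 ↑ʳ_) (β-aut u u' u≢u') ⟩
    3 ↑ʳ E u u'                 ∎
    where open ≡-Reasoning

  ActsAs : Perm (V × Fin 2) → Perm V → Set
  ActsAs τ β = ∀ x i → app τ (x , i) ≡ (app β x , i)

  lift-IsAut : ∀ β → IsAut E β → ∀ τ → ActsAs τ β → IsAut double τ
  lift-IsAut β β-aut τ acts (u , i) (u' , j) _ =
    trans (cong₂ double (acts u i) (acts u' j)) (double-β i j)
    where
    double-β : ∀ i j → double (app β u , i) (app β u' , j) ≡ double (u , i) (u' , j)
    double-β zero       zero       = refl
    double-β zero       (suc zero) = arc-IsAut β β-aut u u'
    double-β (suc zero) zero       = arc-IsAut β β-aut u' u
    double-β (suc zero) (suc zero) = refl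

  module _ (another : (u : V) → ∃[ u' ] u' ≢ u) (τ : Perm (V × Fin 2)) (τ-aut : IsAut double τ) where

    keeps-layer : ∀ x i → proj₂ (app τ (x , i)) ≡ i
    keeps-layer x i with another x
    ... | x' , x'≢x = double≡inner⇒layer (app τ (x , i)) (app τ (x' , i)) i
      (trans (τ-aut (x , i) (x' , i) (x'≢x ∘ sym ∘ cong proj₁)) (double-within x x' i))

    open LayerPreserving τ keeps-layer

    fibres-agree : ∀ x → app (fibre zero) x ≡ app (fibre (suc zero)) x
    fibres-agree x = arc≡rung⇒≡ _ _ (begin
      arc (app (fibre zero) x) (app (fibre (suc zero)) x)
        ≡⟨ sym (cong₂ double (app-fibre x zero) (app-fibre x (suc zero))) ⟩
      double (app τ (x , zero)) (app τ (x , suc zero)) ≡⟨ τ-aut _ _ (λ ()) ⟩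
      arc x x                                          ≡⟨ arc-refl x ⟩
      rung                                             ∎)
      where open ≡-Reasoning

    fibre-IsAut : IsAut E (fibre zero)
    fibre-IsAut u u' u≢u' = arc≡↑ʳ⇒E≡ _ _ (E u u') (begin
      arc (app (fibre zero) u) (app (fibre zero) u')
        ≡⟨ cong (arc _) (fibres-agree u') ⟩
      arc (app (fibre zero) u) (app (fibre (suc zero)) u')
        ≡⟨ sym (cong₂ double (app-fibre u zero) (app-fibre u' (suc zero))) ⟩
      double (app τ (u , zero)) (app τ (u' , suc zero)) ≡⟨ τ-aut _ _ (u≢u' ∘ cong proj₁) ⟩
      arc u u'                                          ≡⟨ arc-≢ u≢u' ⟩
      3 ↑ʳ E u u'                                       ∎)
      where open ≡-Reasoning

    acts-as-fibre : ActsAs τ (fibre zero)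
    acts-as-fibre x zero       = app-fibre x zero
    acts-as-fibre x (suc zero) = trans (app-fibre x (suc zero)) (cong (_, suc zero) (sym (fibres-agree x)))

  doubling-IsAutGroupOf : ((u : V) → ∃[ u' ] u' ≢ u) → (A : PermGroup V) →
                          IsAutGroupOf A E → IsAutGroupOf (A ×I₂) double
  doubling-IsAutGroupOf another A A≡AutE τ = mk⇔
    (λ (mk×I₂ β β∈A acts) → lift-IsAut β (Equivalence.to (A≡AutE β) β∈A) τ acts)
    (λ τ-aut → let β = LayerPreserving.fibre τ (keeps-layer another τ τ-aut) zero in
      mk×I₂ β (Equivalence.from (A≡AutE β) (fibre-IsAut another τ τ-aut)) (acts-as-fibre another τ τ-aut))

lemma3p13 : {V : Set} → Finite V → (A : PermGroup V) →
    InDGR A → ¬ InGR A → InGR (A ×I₂)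
lemma3p13 fin A (k , E , A≡AutE) A∉GR =
  3 + k , (double , double-sym) , doubling-IsAutGroupOf (¬InGR⇒another fin A A∉GR) A A≡AutE
  where open Doubling (finite⇒≟ fin) E
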